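{- Let $S$ be a strong clique of a graph $G$, and suppose $G$ is $S$-minimal. Then: (i) every vertex of $G$ is incident with some edge in $S$; (ii) the diameter of $G$ is at most $3$; (iii) for every edge $uv\in E(G)\setminus S$, there are two edges $uu',vv'\in S$ such that $uv$ is the only edge joining $\{u,u'\}$ and $\{v,v'\}$; (iv) if $S$ is a maximum strong clique of $G$, then for every edge $uv\in E(G)\setminus S$ there is an edge $xy\in S$ whose distance from $uv$ in $G$ is at least $3$.
   Context: All graphs are finite and simple. The distance between two edges of $G$ is the distance between the corresponding vertices in the line graph of $G$. A strong clique of $G$ is a set $S$ of edges such that every pair of edges in $S$ has distance at most $2$; it is maximum if it has the largest possible size. For a strong clique $S$ of $G$, $G$ is $S$-minimal if $S$ is not a strong clique of any proper subgraph of $G$ (i.e., removing any vertex or edge of $G$ makes $S$ no longer a strong clique of the resulting graph, where removing a vertex incident to an edge of $S$ automatically destroys this). -}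

module Defs where

open import Data.Nat using (ℕ; zero; suc; _≤_)
open import Data.Fin using (Fin; toℕ; _<?_)
open import Data.Bool using (Bool; true; false; if_then_else_; _∧_)
open import Data.List using (List; map; allFin)
open import Data.Nat.ListAction using (sum)
open import Data.Product using (Σ; _×_; _,_; ∃)
open import Data.Sum using (_⊎_)
open import Relation.Nullary using (¬_)
open import Relation.Nullary.Decidable using (⌊_⌋)
open import Relation.Binary.PropositionalEquality using (_≡_)

-- A finite simple graph whose vertex set is a subset of Fin n
-- (given by 'vert'); edges are given by a symmetric, irreflexive
-- Boolean adjacency relation between vertices of the graph.
record Graph (n : ℕ) : Set where
  field
    vert   : Fin n → Bool
    adj    : Fin n → Fin n → Bool
    sym    : ∀ u v → adj u v ≡ adj v u
    irrefl : ∀ u → adj u u ≡ false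
    closed : ∀ u v → adj u v ≡ true → vert u ≡ true
open Graph public

record EdgeSet (n : ℕ) : Set where
  field
    mem    : Fin n → Fin n → Bool
    memSym : ∀ u v → mem u v ≡ mem v u
open EdgeSet public

edgeCount : ∀ {n} → EdgeSet n → ℕ
edgeCount {n} S =
  sum (map (λ u → sum (map (λ v → if mem S u v ∧ ⌊ u <? v ⌋ then 1 else 0)
                             (allFin n)))
           (allFin n))

ShareEnd : ∀ {n} → Fin n → Fin n → Fin n → Fin n → Set
ShareEnd u v x y = (u ≡ x ⊎ u ≡ y) ⊎ (v ≡ x ⊎ v ≡ y)

-- distance between edges uv and xy in the line graph of G is at most 2:
-- either they are equal or adjacent in L(G), or some edge ab of G is
-- adjacent (in L(G)) to both of them.
EDist≤2 : ∀ {n} → Graph n → Fin n → Fin n → Fin n → Fin n → Set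
EDist≤2 {n} G u v x y =
  ShareEnd u v x y ⊎
  Σ (Fin n) (λ a → Σ (Fin n) (λ b →
     adj G a b ≡ true × ShareEnd u v a b × ShareEnd a b x y))

StrongClique : ∀ {n} → Graph n → EdgeSet n → Set
StrongClique {n} G S =
  (∀ (u v : Fin n) → mem S u v ≡ true → adj G u v ≡ true) ×
  (∀ (u v x y : Fin n) → mem S u v ≡ true → mem S x y ≡ true →
     EDist≤2 G u v x y)

Subgraph : ∀ {n} → Graph n → Graph n → Set
Subgraph {n} H G =
  (∀ (u : Fin n) → vert H u ≡ true → vert G u ≡ true) ×
  (∀ (u v : Fin n) → adj H u v ≡ true → adj G u v ≡ true)

ProperSubgraph : ∀ {n} → Graph n → Graph n → Set
ProperSubgraph {n} H G =
  Subgraph H G ×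
  ((Σ (Fin n) λ u → vert G u ≡ true × vert H u ≡ false) ⊎
   (Σ (Fin n) λ u → Σ (Fin n) λ v → adj G u v ≡ true × adj H u v ≡ false))

Minimal : ∀ {n} → Graph n → EdgeSet n → Set
Minimal {n} G S = ∀ (H : Graph n) → ProperSubgraph H G → ¬ StrongClique H S

MaximumStrongClique : ∀ {n} → Graph n → EdgeSet n → Set
MaximumStrongClique {n} G S =
  StrongClique G S × (∀ (T : EdgeSet n) → StrongClique G T → edgeCount T ≤ edgeCount S)

data Dist≤ {n : ℕ} (G : Graph n) : ℕ → Fin n → Fin n → Set where
  here : ∀ {k u} → Dist≤ G k u u
  step : ∀ {k u w v} → adj G u w ≡ true → Dist≤ G k w v → Dist≤ G (suc k) u v

Diam≤ : ∀ {n} → Graph n → ℕ → Set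
Diam≤ {n} G k = ∀ (u v : Fin n) → vert G u ≡ true → vert G v ≡ true → Dist≤ G k u v

-- If a vertex u meets no edge of S, S stays a strong clique of G − u: an edge through u
-- linking two S-edges meets both at its other end, so they touch. If uv ∉ S and every pair
-- of S-edges uu', vv' were still within distance 2 in G − uv, then S would stay a strong
-- clique of G − uv, since uv can only serve as the middle edge for such a pair; a failing
-- pair gives (iii). Part (ii) follows from (i), as the S-edges at u and at v are joined
-- through at most one middle edge. For (iv), if every S-edge were within distance 2 of uv,
-- adding uv to S would give a larger strong clique.
module Submission where

open import Defs
open import Data.Nat using (ℕ; _≤_; _<_; _+_; z≤n; s≤s)
open import Data.Nat.Properties
  using (≤-refl; n≤1+n; m≤n+m; +-mono-≤; +-mono-<-≤; +-mono-≤-<; <-irrefl; <-≤-trans)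
open import Data.Nat.ListAction using (sum)
open import Data.Fin using (Fin; _<?_)
import Data.Fin as Fin
open import Data.Fin.Properties using (_≟_; any?; <-cmp)
open import Data.Bool using (Bool; true; false; not; _∧_; _∨_; if_then_else_)
open import Data.Bool.Properties using (∧-comm; ∧-zeroʳ; ∧-conicalˡ; ∧-conicalʳ; ∨-zeroʳ)
import Data.Bool.Properties as Bool
open import Data.List using (List; []; _∷_; map; allFin)
open import Data.List.Relation.Unary.Any using (here; there)
open import Data.List.Membership.Propositional using (_∈_)
open import Data.List.Membership.Propositional.Properties using (∈-allFin)
open import Data.Product using (Σ; _×_; _,_)
open import Data.Sum using (_⊎_; inj₁; inj₂)
import Data.Sum as Sum
open import Data.Empty using (⊥-elim)
open import Function.Bundles using (mk⇔)
open import Relation.Nullary using (¬_; Dec; yes; no; does)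
open import Relation.Nullary.Decidable
  using (⌊_⌋; _×-dec_; _⊎-dec_; ¬?; decidable-stable; dec-true; dec-false; does-⇔)
open import Relation.Binary using (tri<; tri≈; tri>)
open import Relation.Binary.PropositionalEquality using (_≡_; _≢_; refl; trans; cong; cong₂)
import Relation.Binary.PropositionalEquality as ≡

private
  variable
    n j k : ℕ
    a b c d u v x y x' y' : Fin n

Endpoint : Fin n → Fin n → Fin n → Set
Endpoint c x y = c ≡ x ⊎ c ≡ y

SameEdge : Fin n → Fin n → Fin n → Fin n → Set
SameEdge a b x y = (a ≡ x × b ≡ y) ⊎ (a ≡ y × b ≡ x)

sameEdge? : (a b x y : Fin n) → Dec (SameEdge a b x y)
sameEdge? a b x y = ((a ≟ x) ×-dec (b ≟ y)) ⊎-dec ((a ≟ y) ×-dec (b ≟ x))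

SameEdge-refl : SameEdge a b a b
SameEdge-refl = inj₁ (refl , refl)

SameEdge-sym : SameEdge a b x y → SameEdge x y a b
SameEdge-sym (inj₁ (refl , refl)) = inj₁ (refl , refl)
SameEdge-sym (inj₂ (refl , refl)) = inj₂ (refl , refl)

SameEdge-swap : SameEdge a b x y → SameEdge b a x y
SameEdge-swap (inj₁ (p , q)) = inj₂ (q , p)
SameEdge-swap (inj₂ (p , q)) = inj₁ (q , p)

does-sameEdge?-swap : (a b x y : Fin n) → does (sameEdge? a b x y) ≡ does (sameEdge? b a x y)
does-sameEdge?-swap a b x y =
  does-⇔ (mk⇔ SameEdge-swap SameEdge-swap) (sameEdge? a b x y) (sameEdge? b a x y)

Endpoint-resp : SameEdge a b x y → Endpoint c a b → Endpoint c x y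
Endpoint-resp (inj₁ (refl , refl)) p = p
Endpoint-resp (inj₂ (refl , refl)) p = Sum.swap p

adj-resp : (G : Graph n) → SameEdge a b x y → adj G x y ≡ true → adj G a b ≡ true
adj-resp G (inj₁ (refl , refl)) e = e
adj-resp {a = a} {b = b} G (inj₂ (refl , refl)) e = trans (Graph.sym G a b) e

adj⇒≢ : (G : Graph n) → adj G u v ≡ true → u ≢ v
adj⇒≢ {u = u} G uv refl with trans (≡.sym (irrefl G u)) uv
... | ()

mem-at-endpoint : (S : EdgeSet n) → mem S x y ≡ true → Endpoint c x y →
  Σ (Fin n) λ c' → mem S c c' ≡ true × SameEdge c c' x y
mem-at-endpoint {y = y} S xy∈S (inj₁ refl) = y , xy∈S , SameEdge-refl
mem-at-endpoint {x = x} {y = y} S xy∈S (inj₂ refl) =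
  x , trans (memSym S y x) xy∈S , inj₂ (refl , refl)

shareEnd? : (u v x y : Fin n) → Dec (ShareEnd u v x y)
shareEnd? u v x y = ((u ≟ x) ⊎-dec (u ≟ y)) ⊎-dec ((v ≟ x) ⊎-dec (v ≟ y))

ShareEnd-refl : ShareEnd u v u v
ShareEnd-refl = inj₁ (inj₁ refl)

ShareEnd-sym : ShareEnd u v x y → ShareEnd x y u v
ShareEnd-sym (inj₁ (inj₁ refl)) = inj₁ (inj₁ refl)
ShareEnd-sym (inj₁ (inj₂ refl)) = inj₂ (inj₁ refl)
ShareEnd-sym (inj₂ (inj₁ refl)) = inj₁ (inj₂ refl)
ShareEnd-sym (inj₂ (inj₂ refl)) = inj₂ (inj₂ refl)

ShareEnd-respˡ : SameEdge a b x y → ShareEnd a b c d → ShareEnd x y c d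
ShareEnd-respˡ (inj₁ (refl , refl)) s = s
ShareEnd-respˡ (inj₂ (refl , refl)) s = Sum.swap s

ShareEnd-respʳ : SameEdge c d x y → ShareEnd a b c d → ShareEnd a b x y
ShareEnd-respʳ e = Sum.map (Endpoint-resp e) (Endpoint-resp e)

common⇒ShareEnd : Endpoint c x y → Endpoint c x' y' → ShareEnd x y x' y'
common⇒ShareEnd (inj₁ refl) q = inj₁ q
common⇒ShareEnd (inj₂ refl) q = inj₂ q

ShareEnd⇒common : ShareEnd x y a b → Σ (Fin _) λ w → Endpoint w x y × Endpoint w a b
ShareEnd⇒common (inj₁ p) = _ , inj₁ refl , p
ShareEnd⇒common (inj₂ p) = _ , inj₂ refl , p

ShareEnd-via-other-end : ShareEnd a b x y → ShareEnd a b x' y' → Endpoint c a b →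
  ¬ Endpoint c x y → ¬ Endpoint c x' y' → ShareEnd x y x' y'
ShareEnd-via-other-end (inj₁ p) (inj₁ q) _ _ _ = common⇒ShareEnd p q
ShareEnd-via-other-end (inj₂ p) (inj₂ q) _ _ _ = common⇒ShareEnd p q
ShareEnd-via-other-end (inj₁ p) (inj₂ _) (inj₁ refl) c∉xy _ = ⊥-elim (c∉xy p)
ShareEnd-via-other-end (inj₁ _) (inj₂ q) (inj₂ refl) _ c∉x'y' = ⊥-elim (c∉x'y' q)
ShareEnd-via-other-end (inj₂ _) (inj₁ q) (inj₁ refl) _ c∉x'y' = ⊥-elim (c∉x'y' q)
ShareEnd-via-other-end (inj₂ p) (inj₁ _) (inj₂ refl) c∉xy _ = ⊥-elim (c∉xy p)

eDist≤2? : (G : Graph n) (u v x y : Fin n) → Dec (EDist≤2 G u v x y)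
eDist≤2? G u v x y = shareEnd? u v x y ⊎-dec
  any? (λ a → any? (λ b → (adj G a b Bool.≟ true) ×-dec shareEnd? u v a b ×-dec shareEnd? a b x y))

EDist≤2-sym : (G : Graph n) → EDist≤2 G u v x y → EDist≤2 G x y u v
EDist≤2-sym G (inj₁ s) = inj₁ (ShareEnd-sym s)
EDist≤2-sym G (inj₂ (a , b , e , s , s')) = inj₂ (a , b , e , ShareEnd-sym s' , ShareEnd-sym s)

EDist≤2-resp : (G : Graph n) → SameEdge a b x y → SameEdge c d x' y' →
  EDist≤2 G a b c d → EDist≤2 G x y x' y'
EDist≤2-resp G e e' (inj₁ s) = inj₁ (ShareEnd-respʳ e' (ShareEnd-respˡ e s))
EDist≤2-resp G e e' (inj₂ (p , q , pq , s , s')) =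
  inj₂ (p , q , pq , ShareEnd-respˡ e s , ShareEnd-respʳ e' s')

EDist≤2-transfer : (G H : Graph n) →
  (∀ a b → adj G a b ≡ true → ShareEnd x y a b → ShareEnd a b x' y' →
     adj H a b ≡ true ⊎ EDist≤2 H x y x' y') →
  EDist≤2 G x y x' y' → EDist≤2 H x y x' y'
EDist≤2-transfer G H kept (inj₁ s) = inj₁ s
EDist≤2-transfer G H kept (inj₂ (a , b , e , s , s')) with kept a b e s s'
... | inj₁ e' = inj₂ (a , b , e' , s , s')
... | inj₂ d = d

restrict : (G : Graph n) (keepV : Fin n → Bool) (keepE : Fin n → Fin n → Bool) →
  (∀ a b → keepE a b ≡ keepE b a) → (∀ a b → keepE a b ≡ true → keepV a ≡ true) → Graph n
restrict G keepV keepE keepE-sym keepE⇒keepV = record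
  { vert   = λ a → keepV a ∧ vert G a
  ; adj    = λ a b → keepE a b ∧ adj G a b
  ; sym    = λ a b → cong₂ _∧_ (keepE-sym a b) (Graph.sym G a b)
  ; irrefl = λ a → trans (cong (keepE a a ∧_) (irrefl G a)) (∧-zeroʳ (keepE a a))
  ; closed = λ a b e → cong₂ _∧_ (keepE⇒keepV a b (∧-conicalˡ (keepE a b) _ e))
                                  (closed G a b (∧-conicalʳ (keepE a b) _ e))
  }

avoids : Fin n → Fin n → Bool
avoids u a = not (does (a ≟ u))

deleteVertex : Graph n → Fin n → Graph n
deleteVertex G u = restrict G (avoids u) (λ a b → avoids u a ∧ avoids u b)
  (λ a b → ∧-comm (avoids u a) (avoids u b)) (λ a b → ∧-conicalˡ (avoids u a) (avoids u b))

deleteVertex-⊆ : (G : Graph n) (u : Fin n) → Subgraph (deleteVertex G u) G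
deleteVertex-⊆ G u =
  (λ a → ∧-conicalʳ (avoids u a) _) , (λ a b → ∧-conicalʳ (avoids u a ∧ avoids u b) _)

deleteVertex-deletes : (G : Graph n) (u : Fin n) → vert (deleteVertex G u) u ≡ false
deleteVertex-deletes G u rewrite dec-true (u ≟ u) refl = refl

deleteVertex-adj : (G : Graph n) → ¬ Endpoint u a b → adj G a b ≡ true →
  adj (deleteVertex G u) a b ≡ true
deleteVertex-adj {u = u} {a = a} {b = b} G u∉ab = cong₂ _∧_ (cong₂ (λ p q → not p ∧ not q)
  (dec-false (a ≟ u) (λ a≡u → u∉ab (inj₁ (≡.sym a≡u))))
  (dec-false (b ≟ u) (λ b≡u → u∉ab (inj₂ (≡.sym b≡u)))))

isNotEdge : Fin n → Fin n → Fin n → Fin n → Bool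
isNotEdge u v a b = not (does (sameEdge? a b u v))

deleteEdge : Graph n → Fin n → Fin n → Graph n
deleteEdge G u v = restrict G (λ _ → true) (isNotEdge u v)
  (λ a b → cong not (does-sameEdge?-swap a b u v))
  (λ _ _ _ → refl)

deleteEdge-⊆ : (G : Graph n) (u v : Fin n) → Subgraph (deleteEdge G u v) G
deleteEdge-⊆ G u v = (λ _ p → p) , (λ a b → ∧-conicalʳ (isNotEdge u v a b) _)

deleteEdge-deletes : (G : Graph n) (u v : Fin n) → adj (deleteEdge G u v) u v ≡ false
deleteEdge-deletes G u v rewrite dec-true (sameEdge? u v u v) (inj₁ (refl , refl)) = refl

deleteEdge-adj : (G : Graph n) → ¬ SameEdge a b u v → adj G a b ≡ true →
  adj (deleteEdge G u v) a b ≡ true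
deleteEdge-adj {a = a} {b = b} {u = u} {v = v} G ab≢uv =
  cong₂ _∧_ (cong not (dec-false (sameEdge? a b u v) ab≢uv))

insertEdge : Fin n → Fin n → EdgeSet n → EdgeSet n
insertEdge u v S = record
  { mem    = λ a b → does (sameEdge? a b u v) ∨ mem S a b
  ; memSym = λ a b → cong₂ _∨_ (does-sameEdge?-swap a b u v) (memSym S a b)
  }

insertEdge-new : (S : EdgeSet n) (u v : Fin n) → mem (insertEdge u v S) u v ≡ true
insertEdge-new S u v rewrite dec-true (sameEdge? u v u v) (inj₁ (refl , refl)) = refl

insertEdge-old : (S : EdgeSet n) → mem S a b ≡ true → mem (insertEdge u v S) a b ≡ true
insertEdge-old S m rewrite m = ∨-zeroʳ _

insertEdge-cases : (S : EdgeSet n) → mem (insertEdge u v S) a b ≡ true →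
  SameEdge a b u v ⊎ mem S a b ≡ true
insertEdge-cases {u = u} {v = v} {a = a} {b = b} S = cases (sameEdge? a b u v)
  where
  cases : (e? : Dec (SameEdge a b u v)) → does e? ∨ mem S a b ≡ true →
    SameEdge a b u v ⊎ mem S a b ≡ true
  cases (yes ab≡uv) _ = inj₁ ab≡uv
  cases (no _) m = inj₂ m

Dist≤-mono : {G : Graph n} → j ≤ k → Dist≤ G j a b → Dist≤ G k a b
Dist≤-mono _ here = here
Dist≤-mono (s≤s j≤k) (step e d) = step e (Dist≤-mono j≤k d)

_++ᵈ_ : {G : Graph n} → Dist≤ G j a b → Dist≤ G k b c → Dist≤ G (j + k) a c
_++ᵈ_ {j = j} {k = k} here q = Dist≤-mono (m≤n+m k j) q
step e p ++ᵈ q = step e (p ++ᵈ q)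

Dist≤1-within-edge : {G : Graph n} → adj G a b ≡ true → Endpoint c a b → Endpoint d a b →
  Dist≤ G 1 c d
Dist≤1-within-edge e (inj₁ refl) (inj₁ refl) = here
Dist≤1-within-edge e (inj₁ refl) (inj₂ refl) = step e here
Dist≤1-within-edge {a = a} {b = b} {G = G} e (inj₂ refl) (inj₁ refl) =
  step (trans (Graph.sym G b a) e) here
Dist≤1-within-edge e (inj₂ refl) (inj₂ refl) = here

EDist≤2⇒Dist≤3 : (G : Graph n) → adj G u x ≡ true → adj G v y ≡ true → EDist≤2 G u x v y →
  Dist≤ G 3 u v
EDist≤2⇒Dist≤3 G ux vy (inj₁ s) with ShareEnd⇒common s
... | w , w∈ux , w∈vy =
  Dist≤-mono (n≤1+n 2)
    (Dist≤1-within-edge ux (inj₁ refl) w∈ux ++ᵈ Dist≤1-within-edge vy w∈vy (inj₁ refl))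
EDist≤2⇒Dist≤3 G ux vy (inj₂ (a , b , ab , s , s')) with ShareEnd⇒common s | ShareEnd⇒common s'
... | w , w∈ux , w∈ab | z , z∈ab , z∈vy =
  Dist≤1-within-edge ux (inj₁ refl) w∈ux ++ᵈ
    (Dist≤1-within-edge ab w∈ab z∈ab ++ᵈ Dist≤1-within-edge vy z∈vy (inj₁ refl))

sum-map-mono : {A : Set} (f g : A → ℕ) (xs : List A) → (∀ x → f x ≤ g x) →
  sum (map f xs) ≤ sum (map g xs)
sum-map-mono f g [] f≤g = z≤n
sum-map-mono f g (x ∷ xs) f≤g = +-mono-≤ (f≤g x) (sum-map-mono f g xs f≤g)

sum-map-< : {A : Set} (f g : A → ℕ) (xs : List A) {x : A} → x ∈ xs →
  (∀ x → f x ≤ g x) → f x < g x → sum (map f xs) < sum (map g xs)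
sum-map-< f g (_ ∷ xs) (here refl) f≤g fx<gx = +-mono-<-≤ fx<gx (sum-map-mono f g xs f≤g)
sum-map-< f g (y ∷ xs) (there x∈xs) f≤g fx<gx =
  +-mono-≤-< (f≤g y) (sum-map-< f g xs x∈xs f≤g fx<gx)

_⊆ₑ_ : EdgeSet n → EdgeSet n → Set
S ⊆ₑ T = ∀ a b → mem S a b ≡ true → mem T a b ≡ true

-- The summand of edgeCount verbatim, so that edgeCount S is definitionally a double sum of these.
edgeIndicator : EdgeSet n → Fin n → Fin n → ℕ
edgeIndicator S a b = if mem S a b ∧ ⌊ a <? b ⌋ then 1 else 0

edgeIndicator-mono : (S T : EdgeSet n) → S ⊆ₑ T → ∀ a b →
  edgeIndicator S a b ≤ edgeIndicator T a b
edgeIndicator-mono S T S⊆T a b with mem S a b in ab∈S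
... | false = z≤n
... | true rewrite S⊆T a b ab∈S = ≤-refl

edgeIndicator-< : (S T : EdgeSet n) → mem S a b ≡ false → mem T a b ≡ true → a Fin.< b →
  edgeIndicator S a b < edgeIndicator T a b
edgeIndicator-< {a = a} {b = b} S T ab∉S ab∈T a<b rewrite ab∉S | ab∈T with a <? b
... | yes _ = s≤s z≤n
... | no a≮b = ⊥-elim (a≮b a<b)

edgeCount-<-ordered : (S T : EdgeSet n) → S ⊆ₑ T → mem S a b ≡ false → mem T a b ≡ true →
  a Fin.< b → edgeCount S < edgeCount T
edgeCount-<-ordered {n} {a} {b} S T S⊆T ab∉S ab∈T a<b =
  sum-map-< (row S) (row T) (allFin n) (∈-allFin a)
    (λ x → sum-map-mono (edgeIndicator S x) (edgeIndicator T x) (allFin n)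
             (edgeIndicator-mono S T S⊆T x))
    (sum-map-< (edgeIndicator S a) (edgeIndicator T a) (allFin n) (∈-allFin b)
      (edgeIndicator-mono S T S⊆T a) (edgeIndicator-< S T ab∉S ab∈T a<b))
  where
  row : EdgeSet n → Fin n → ℕ
  row R x = sum (map (edgeIndicator R x) (allFin n))

edgeCount-< : (S T : EdgeSet n) → S ⊆ₑ T → mem S a b ≡ false → mem T a b ≡ true → a ≢ b →
  edgeCount S < edgeCount T
edgeCount-< {a = a} {b = b} S T S⊆T ab∉S ab∈T a≢b with <-cmp a b
... | tri< a<b _ _ = edgeCount-<-ordered S T S⊆T ab∉S ab∈T a<b
... | tri≈ _ a≡b _ = ⊥-elim (a≢b a≡b)
... | tri> _ _ b<a =
  edgeCount-<-ordered S T S⊆T (trans (memSym S b a) ab∉S) (trans (memSym T b a) ab∈T) b<a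

Covered : EdgeSet n → Fin n → Set
Covered S u = Σ (Fin _) λ v → mem S u v ≡ true

StrongClique-deleteVertex : (G : Graph n) (S : EdgeSet n) → StrongClique G S → ¬ Covered S u →
  StrongClique (deleteVertex G u) S
StrongClique-deleteVertex {u = u} G S (S⊆G , S-close) uncovered = S⊆H , H-close
  where
  H : Graph _
  H = deleteVertex G u

  u∉ : mem S x y ≡ true → ¬ Endpoint u x y
  u∉ {y = y} xy∈S (inj₁ refl) = uncovered (y , xy∈S)
  u∉ {x = x} {y = y} xy∈S (inj₂ refl) = uncovered (x , trans (memSym S y x) xy∈S)

  S⊆H : ∀ x y → mem S x y ≡ true → adj H x y ≡ true
  S⊆H x y xy∈S = deleteVertex-adj G (u∉ xy∈S) (S⊆G x y xy∈S)

  H-close : ∀ x y x' y' → mem S x y ≡ true → mem S x' y' ≡ true → EDist≤2 H x y x' y'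
  H-close x y x' y' xy∈S x'y'∈S = EDist≤2-transfer G H kept (S-close x y x' y' xy∈S x'y'∈S)
    where
    kept : ∀ a b → adj G a b ≡ true → ShareEnd x y a b → ShareEnd a b x' y' →
      adj H a b ≡ true ⊎ EDist≤2 H x y x' y'
    kept a b ab s s' with (u ≟ a) ⊎-dec (u ≟ b)
    ... | yes u∈ab =
      inj₂ (inj₁ (ShareEnd-via-other-end (ShareEnd-sym s) s' u∈ab (u∉ xy∈S) (u∉ x'y'∈S)))
    ... | no u∉ab = inj₁ (deleteVertex-adj G u∉ab ab)

StrongClique-deleteEdge : (G : Graph n) (S : EdgeSet n) → StrongClique G S → mem S u v ≡ false →
  (∀ u' v' → mem S u u' ≡ true → mem S v v' ≡ true → EDist≤2 (deleteEdge G u v) u u' v v') →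
  StrongClique (deleteEdge G u v) S
StrongClique-deleteEdge {u = u} {v = v} G S (S⊆G , S-close) uv∉S uv-pairs-close = S⊆H , H-close
  where
  H : Graph _
  H = deleteEdge G u v

  S⊆H : ∀ x y → mem S x y ≡ true → adj H x y ≡ true
  S⊆H x y xy∈S = deleteEdge-adj G xy≢uv (S⊆G x y xy∈S)
    where
    xy≢uv : ¬ SameEdge x y u v
    xy≢uv (inj₁ (refl , refl)) with trans (≡.sym uv∉S) xy∈S
    ... | ()
    xy≢uv (inj₂ (refl , refl)) with trans (≡.sym uv∉S) (trans (memSym S u v) xy∈S)
    ... | ()

  across : mem S x y ≡ true → mem S x' y' ≡ true → Endpoint u x y → Endpoint v x' y' →
    EDist≤2 H x y x' y'
  across xy∈S x'y'∈S u∈xy v∈x'y'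
    with mem-at-endpoint S xy∈S u∈xy | mem-at-endpoint S x'y'∈S v∈x'y'
  ... | u' , uu'∈S , uu'≡xy | v' , vv'∈S , vv'≡x'y' =
    EDist≤2-resp H uu'≡xy vv'≡x'y' (uv-pairs-close u' v' uu'∈S vv'∈S)

  through-uv : mem S x y ≡ true → mem S x' y' ≡ true → ShareEnd u v x y → ShareEnd u v x' y' →
    EDist≤2 H x y x' y'
  through-uv _ _ (inj₁ p) (inj₁ q) = inj₁ (common⇒ShareEnd p q)
  through-uv _ _ (inj₂ p) (inj₂ q) = inj₁ (common⇒ShareEnd p q)
  through-uv xy∈S x'y'∈S (inj₁ p) (inj₂ q) = across xy∈S x'y'∈S p q
  through-uv xy∈S x'y'∈S (inj₂ p) (inj₁ q) = EDist≤2-sym H (across x'y'∈S xy∈S q p)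

  H-close : ∀ x y x' y' → mem S x y ≡ true → mem S x' y' ≡ true → EDist≤2 H x y x' y'
  H-close x y x' y' xy∈S x'y'∈S = EDist≤2-transfer G H kept (S-close x y x' y' xy∈S x'y'∈S)
    where
    kept : ∀ a b → adj G a b ≡ true → ShareEnd x y a b → ShareEnd a b x' y' →
      adj H a b ≡ true ⊎ EDist≤2 H x y x' y'
    kept a b ab s s' with sameEdge? a b u v
    ... | yes ab≡uv = inj₂ (through-uv xy∈S x'y'∈S
                                (ShareEnd-sym (ShareEnd-respʳ ab≡uv s)) (ShareEnd-respˡ ab≡uv s'))
    ... | no ab≢uv = inj₁ (deleteEdge-adj G ab≢uv ab)

StrongClique-insertEdge : (G : Graph n) (S : EdgeSet n) → StrongClique G S → adj G u v ≡ true →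
  (∀ x y → mem S x y ≡ true → EDist≤2 G u v x y) → StrongClique G (insertEdge u v S)
StrongClique-insertEdge {u = u} {v = v} G S (S⊆G , S-close) uv uv-close = T⊆G , T-close
  where
  T⊆G : ∀ x y → mem (insertEdge u v S) x y ≡ true → adj G x y ≡ true
  T⊆G x y xy∈T with insertEdge-cases S xy∈T
  ... | inj₁ xy≡uv = adj-resp G xy≡uv uv
  ... | inj₂ xy∈S = S⊆G x y xy∈S

  T-close : ∀ x y x' y' →
    mem (insertEdge u v S) x y ≡ true → mem (insertEdge u v S) x' y' ≡ true →
    EDist≤2 G x y x' y'
  T-close x y x' y' xy∈T x'y'∈T with insertEdge-cases S xy∈T | insertEdge-cases S x'y'∈T
  ... | inj₂ xy∈S | inj₂ x'y'∈S = S-close x y x' y' xy∈S x'y'∈S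
  ... | inj₁ xy≡uv | inj₂ x'y'∈S =
    EDist≤2-resp G (SameEdge-sym xy≡uv) SameEdge-refl (uv-close x' y' x'y'∈S)
  ... | inj₂ xy∈S | inj₁ x'y'≡uv =
    EDist≤2-sym G (EDist≤2-resp G (SameEdge-sym x'y'≡uv) SameEdge-refl (uv-close x y xy∈S))
  ... | inj₁ xy≡uv | inj₁ x'y'≡uv =
    inj₁ (ShareEnd-respˡ (SameEdge-sym xy≡uv) (ShareEnd-respʳ (SameEdge-sym x'y'≡uv) ShareEnd-refl))

minimal⇒covered : (G : Graph n) (S : EdgeSet n) → StrongClique G S → Minimal G S →
  ∀ u → vert G u ≡ true → Covered S u
minimal⇒covered G S clique minimal u u∈G with any? (λ v → mem S u v Bool.≟ true)
... | yes covered = covered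
... | no uncovered = ⊥-elim (minimal (deleteVertex G u)
  (deleteVertex-⊆ G u , inj₁ (u , u∈G , deleteVertex-deletes G u))
  (StrongClique-deleteVertex G S clique uncovered))

covered⇒Diam≤3 : (G : Graph n) (S : EdgeSet n) → StrongClique G S →
  (∀ u → vert G u ≡ true → Covered S u) → Diam≤ G 3
covered⇒Diam≤3 G S (S⊆G , S-close) covered u v u∈G v∈G with covered u u∈G | covered v v∈G
... | u' , uu'∈S | v' , vv'∈S =
  EDist≤2⇒Dist≤3 G (S⊆G u u' uu'∈S) (S⊆G v v' vv'∈S) (S-close u u' v v' uu'∈S vv'∈S)

deleteEdge-far⇒only-edge : (G : Graph n) → ¬ EDist≤2 (deleteEdge G u v) u x v y →
  ∀ a b → Endpoint a u x → Endpoint b v y → adj G a b ≡ true → SameEdge a b u v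
deleteEdge-far⇒only-edge {u = u} {v = v} G far a b a∈ux b∈vy ab with sameEdge? a b u v
... | yes ab≡uv = ab≡uv
... | no ab≢uv =
  ⊥-elim (far (inj₂ (a , b , deleteEdge-adj G ab≢uv ab , ShareEnd-sym (inj₁ a∈ux) , inj₂ b∈vy)))

minimal⇒only-edge : (G : Graph n) (S : EdgeSet n) → StrongClique G S → Minimal G S →
  adj G u v ≡ true → mem S u v ≡ false →
  Σ (Fin n) λ u' → Σ (Fin n) λ v' → mem S u u' ≡ true × mem S v v' ≡ true ×
    (∀ a b → Endpoint a u u' → Endpoint b v v' → adj G a b ≡ true → SameEdge a b u v)
minimal⇒only-edge {u = u} {v = v} G S clique minimal uv uv∉S with
  any? (λ u' → any? (λ v' → (mem S u u' Bool.≟ true) ×-dec (mem S v v' Bool.≟ true) ×-dec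
                             ¬? (eDist≤2? (deleteEdge G u v) u u' v v')))
... | yes (u' , v' , uu'∈S , vv'∈S , far) = u' , v' , uu'∈S , vv'∈S , deleteEdge-far⇒only-edge G far
... | no no-far-pair = ⊥-elim (minimal (deleteEdge G u v)
  (deleteEdge-⊆ G u v , inj₂ (u , v , uv , deleteEdge-deletes G u v))
  (StrongClique-deleteEdge G S clique uv∉S λ u' v' uu'∈S vv'∈S →
    decidable-stable (eDist≤2? (deleteEdge G u v) u u' v v') λ far →
      no-far-pair (u' , v' , uu'∈S , vv'∈S , far)))

maximum⇒far-edge : (G : Graph n) (S : EdgeSet n) → MaximumStrongClique G S →
  adj G u v ≡ true → mem S u v ≡ false →
  Σ (Fin n) λ x → Σ (Fin n) λ y → mem S x y ≡ true × ¬ EDist≤2 G u v x y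
maximum⇒far-edge {u = u} {v = v} G S (clique , maximum) uv uv∉S with
  any? (λ x → any? (λ y → (mem S x y Bool.≟ true) ×-dec ¬? (eDist≤2? G u v x y)))
... | yes far-edge = far-edge
... | no no-far-edge = ⊥-elim (<-irrefl refl (<-≤-trans
  (edgeCount-< S (insertEdge u v S) (λ a b → insertEdge-old S) uv∉S (insertEdge-new S u v)
    (adj⇒≢ G uv))
  (maximum (insertEdge u v S) (StrongClique-insertEdge G S clique uv λ x y xy∈S →
    decidable-stable (eDist≤2? G u v x y) λ far → no-far-edge (x , y , xy∈S , far)))))

lemma2p2 : ∀ {n : ℕ} (G : Graph n) (S : EdgeSet n) →
    StrongClique G S → Minimal G S →
    -- (i)
    (∀ (u : Fin n) → vert G u ≡ true → Σ (Fin n) λ v → mem S u v ≡ true) ×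
    -- (ii)
    Diam≤ G 3 ×
    -- (iii)
    (∀ (u v : Fin n) → adj G u v ≡ true → mem S u v ≡ false →
      Σ (Fin n) λ u' → Σ (Fin n) λ v' →
        mem S u u' ≡ true × mem S v v' ≡ true ×
        (∀ (a b : Fin n) → (a ≡ u ⊎ a ≡ u') → (b ≡ v ⊎ b ≡ v') → adj G a b ≡ true →
          (a ≡ u × b ≡ v) ⊎ (a ≡ v × b ≡ u))) ×
    -- (iv)
    (MaximumStrongClique G S →
      ∀ (u v : Fin n) → adj G u v ≡ true → mem S u v ≡ false →
        Σ (Fin n) λ x → Σ (Fin n) λ y → mem S x y ≡ true × ¬ EDist≤2 G u v x y)
lemma2p2 G S clique minimal =
  minimal⇒covered G S clique minimal ,
  covered⇒Diam≤3 G S clique (minimal⇒covered G S clique minimal) ,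
  (λ u v → minimal⇒only-edge G S clique minimal) ,
  (λ maximum u v → maximum⇒far-edge G S maximum)
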